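{- Let $T$ be an $n$-vertex tournament with an optimal ordering $v_1,\ldots,v_n$ of its vertices, and let $B$ be the set of backwards edges in this ordering, with $|B|=\alpha n^2$. Suppose that the subset $B'\subseteq B$ of backwards edges of length at least $n/16$ satisfies $|B'|\geq \alpha n^2/4$. If $\alpha\le 2^{ -16}$, then there exists $B''\subseteq B'$ with $|B''|\geq |B'|/2$ such that every edge of $B''$ lies in at least $n/64$ directed triangles in $T$.
   Context: A tournament is an orientation of a complete graph. Given an ordering $v_1,\ldots,v_n$ of the vertices, a backwards edge is an edge directed from $v_j$ to $v_i$ with $i<j$; its length is $j-i$. An ordering is optimal if it minimizes the number of backwards edges over all orderings. A directed triangle is a set of three vertices $x,y,z$ with edges $x\to y$, $y\to z$, $z\to x$; an edge lies in a directed triangle if both its endpoints are among the triangle's vertices. -}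

module Defs where

open import Data.Nat using (ℕ; zero; suc; _+_; _*_; _∸_; _≤_; _<ᵇ_; _≤ᵇ_)
open import Data.Bool using (Bool; true; false; not; _∧_; if_then_else_)
open import Data.Fin using (Fin; toℕ)
open import Data.Fin.Permutation using (Permutation′; _⟨$⟩ʳ_)
open import Data.List using (List; map; cartesianProduct; allFin)
open import Data.Nat.ListAction using (sum)
open import Data.Product using (_×_; _,_; proj₁; proj₂)
open import Relation.Binary.PropositionalEquality using (_≡_; _≢_)

-- A tournament on vertex set Fin n: adj u v = true iff the edge is directed u → v.
record Tournament (n : ℕ) : Set where
  field
    adj     : Fin n → Fin n → Bool
    irrefl  : ∀ u → adj u u ≡ false
    tourn   : ∀ u v → u ≢ v → adj u v ≡ not (adj v u)
open Tournament public

countV : ∀ {n} → (Fin n → Bool) → ℕ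
countV {n} P = sum (map (λ w → if P w then 1 else 0) (allFin n))

countP : ∀ {n} → (Fin n → Fin n → Bool) → ℕ
countP {n} P = sum (map (λ p → if P (proj₁ p) (proj₂ p) then 1 else 0)
                        (cartesianProduct (allFin n) (allFin n)))

-- An ordering v_1..v_n is a permutation σ : position ↦ vertex (v_i = σ ⟨$⟩ʳ i).
-- The pair of positions (i , j) is a backwards edge iff i < j and v_j → v_i.
isBack : ∀ {n} → Tournament n → Permutation′ n → Fin n → Fin n → Bool
isBack T σ i j = (toℕ i <ᵇ toℕ j) ∧ adj T (σ ⟨$⟩ʳ j) (σ ⟨$⟩ʳ i)

backCount : ∀ {n} → Tournament n → Permutation′ n → ℕ
backCount T σ = countP (isBack T σ)

Optimal : ∀ {n} → Tournament n → Permutation′ n → Set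
Optimal T σ = ∀ τ → backCount T σ ≤ backCount T τ

-- Backwards edges of length j - i ≥ n/16 (i.e. n ≤ 16 (j - i)).
isLongBack : ∀ {n} → Tournament n → Permutation′ n → Fin n → Fin n → Bool
isLongBack {n} T σ i j = isBack T σ i j ∧ (n ≤ᵇ 16 * (toℕ j ∸ toℕ i))

-- Number of directed triangles containing the edge {v_i , v_j}, i.e. the number
-- of third vertices w with v_i → w → v_j and v_j → v_i
-- (for a backwards edge v_j → v_i the triangle must be v_j → v_i → w → v_j).
trianglesThrough : ∀ {n} → Tournament n → Permutation′ n → Fin n → Fin n → ℕ
trianglesThrough T σ i j =
  countV (λ w → adj T (σ ⟨$⟩ʳ j) (σ ⟨$⟩ʳ i) ∧ adj T (σ ⟨$⟩ʳ i) w ∧ adj T w (σ ⟨$⟩ʳ j))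

-- Moving one vertex of an optimal ordering cannot decrease the number of backward edges. Moving
-- v_i to just after v_j shows that at most half of v_{i+1}, …, v_j beat v_i; moving v_j to just
-- before v_i shows that v_j beats at most half of v_i, …, v_{j-1}. For a backward edge v_j → v_i
-- every v_p with i ≤ p ≤ j beats v_i, is beaten by v_j, or closes the directed triangle
-- v_j → v_i → v_p → v_j. Hence if j - i ≥ n/16 and v_i has at most n/64 backward edges to its
-- right (or v_j at most n/64 to its left), the edge lies in at least n/64 directed triangles.
-- By Markov's inequality at most 64|B|/n vertices violate each condition, so at most
-- (64|B|/n)² ≤ |B|/16 ≤ |B'|/4 long backward edges violate both, and B'' consists of the others.

module Submission where

open import Defs
open import Data.Bool using (Bool; true; false; not; _∧_; if_then_else_)
open import Data.Bool.Properties using (∧-zeroʳ; ∧-conicalˡ; ∧-conicalʳ; T-≡)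
open import Data.Fin using (Fin; toℕ; punchIn) renaming (zero to 0F; suc to sucF)
import Data.Fin as Fin
open import Data.Fin.Permutation
  using (Permutation′; _⟨$⟩ʳ_; _⟨$⟩ˡ_; flip; _∘ₚ_; inverseˡ; insert; insert-punchIn; id)
open import Data.Fin.Properties using (toℕ<n; toℕ≤pred[n]; toℕ-injective; punchInᵢ≢i)
open import Data.List using (List; []; _∷_; _++_; map; tabulate; cartesianProduct; allFin)
open import Data.List.Properties using (map-++; map-∘)
open import Data.Nat using (ℕ; zero; suc; _+_; _*_; _^_; _∸_; _≤_; _<_; _<ᵇ_; _≤ᵇ_; z≤n; s≤s)
import Data.Nat.ListAction as List
open import Data.Nat.ListAction.Properties using (sum-++)
open import Data.Nat.Properties
open import Data.Nat.Tactic.RingSolver using (solve)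
open import Data.Product using (Σ; _×_; _,_; proj₁; proj₂)
open import Data.Sum using (_⊎_; inj₁; inj₂; [_,_]′) renaming (map to map-⊎)
open import Function using (_∘_)
open import Function.Bundles using (Equivalence)
open import Relation.Binary.PropositionalEquality
open import Relation.Nullary using (contradiction; yes; no)
open import Relation.Nullary.Reflects using (ofʸ; ofⁿ)

open import Algebra.Properties.CommutativeSemigroup +-commutativeSemigroup using (xy∙z≈xz∙y)
open import Algebra.Properties.Semiring.Sum +-*-semiring
  using (sum; sum-syntax; sum-cong-≗; sum-remove; sum-replicate-zero; sum-permute;
         ∑-comm; ∑-distrib-+; *-distribˡ-sum; *-distribʳ-sum)

<ᵇ-irrefl : ∀ n → (n <ᵇ n) ≡ false
<ᵇ-irrefl zero    = refl
<ᵇ-irrefl (suc n) = <ᵇ-irrefl n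

≤ᵇ≡<ᵇsuc : ∀ m n → (m ≤ᵇ n) ≡ (m <ᵇ suc n)
≤ᵇ≡<ᵇsuc zero    n = refl
≤ᵇ≡<ᵇsuc (suc m) n = refl

<⇒<ᵇ≡true : ∀ {m n} → m < n → (m <ᵇ n) ≡ true
<⇒<ᵇ≡true m<n = Equivalence.to T-≡ (<⇒<ᵇ m<n)

≤⇒≤ᵇ≡true : ∀ {m n} → m ≤ n → (m ≤ᵇ n) ≡ true
≤⇒≤ᵇ≡true m≤n = Equivalence.to T-≡ (≤⇒≤ᵇ m≤n)

<ᵇ≡true⇒< : ∀ {m n} → (m <ᵇ n) ≡ true → m < n
<ᵇ≡true⇒< {m} {n} e = <ᵇ⇒< m n (Equivalence.from T-≡ e)

≤ᵇ≡true⇒≤ : ∀ {m n} → (m ≤ᵇ n) ≡ true → m ≤ n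
≤ᵇ≡true⇒≤ {m} {n} e = ≤ᵇ⇒≤ m n (Equivalence.from T-≡ e)

+-≡-cancel-≤ : ∀ {a b x y} → a + x ≡ b + y → b ≤ a → x ≤ y
+-≡-cancel-≤ {a} {b} {x} {y} a+x≡b+y b≤a =
  +-cancelˡ-≤ b x y (≤-trans (+-monoˡ-≤ x b≤a) (≤-reflexive a+x≡b+y))

not-∧≡true : ∀ x y → not (x ∧ y) ≡ true → x ≡ false ⊎ y ≡ false
not-∧≡true false y     _ = inj₁ refl
not-∧≡true true  false _ = inj₂ refl

𝟙 : Bool → ℕ
𝟙 b = if b then 1 else 0

𝟙-∧ : ∀ x y → 𝟙 (x ∧ y) ≡ 𝟙 x * 𝟙 y
𝟙-∧ false y = refl
𝟙-∧ true  y = sym (+-identityʳ (𝟙 y))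

𝟙-∧-not : ∀ x y → 𝟙 (x ∧ y) + 𝟙 (x ∧ not y) ≡ 𝟙 x
𝟙-∧-not false y     = refl
𝟙-∧-not true  false = refl
𝟙-∧-not true  true  = refl

𝟙-∧-≤ʳ : ∀ x y → 𝟙 (x ∧ y) ≤ 𝟙 y
𝟙-∧-≤ʳ false y = z≤n
𝟙-∧-≤ʳ true  y = ≤-refl

𝟙-∧-dropʳ : ∀ x y z → 𝟙 ((x ∧ y) ∧ z) ≤ 𝟙 (x ∧ z)
𝟙-∧-dropʳ false y z     = z≤n
𝟙-∧-dropʳ true  false z = z≤n
𝟙-∧-dropʳ true  true  z = ≤-refl

𝟙-∧-dropˡ : ∀ x y z → 𝟙 ((x ∧ y) ∧ z) ≤ 𝟙 (y ∧ z)
𝟙-∧-dropˡ false y z = z≤n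
𝟙-∧-dropˡ true  y z = ≤-refl

𝟙-∧-split : ∀ b b₁ b₂ x → 𝟙 b ≡ 𝟙 b₁ + 𝟙 b₂ → 𝟙 (b ∧ x) ≡ 𝟙 (b₁ ∧ x) + 𝟙 (b₂ ∧ x)
𝟙-∧-split b b₁ b₂ x split = begin
  𝟙 (b ∧ x)                          ≡⟨ 𝟙-∧ b x ⟩
  𝟙 b * 𝟙 x                          ≡⟨ cong (_* 𝟙 x) split ⟩
  (𝟙 b₁ + 𝟙 b₂) * 𝟙 x                ≡⟨ *-distribʳ-+ (𝟙 x) (𝟙 b₁) (𝟙 b₂) ⟩
  𝟙 b₁ * 𝟙 x + 𝟙 b₂ * 𝟙 x            ≡⟨ sym (cong₂ _+_ (𝟙-∧ b₁ x) (𝟙-∧ b₂ x)) ⟩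
  𝟙 (b₁ ∧ x) + 𝟙 (b₂ ∧ x)            ∎
  where open ≡-Reasoning

𝟙-cover : ∀ {x} y z w → (x ≡ true → y ≡ true ⊎ z ≡ true ⊎ w ≡ true) → 𝟙 x ≤ 𝟙 y + 𝟙 z + 𝟙 w
𝟙-cover {false} y z w _ = z≤n
𝟙-cover {true}  y z w cover with cover refl
... | inj₁ refl        = ≤-trans (m≤m+n 1 (𝟙 z)) (m≤m+n _ (𝟙 w))
... | inj₂ (inj₁ refl) = ≤-trans (m≤n+m 1 (𝟙 y)) (m≤m+n _ (𝟙 w))
... | inj₂ (inj₂ refl) = m≤n+m 1 _

*-𝟙-<ᵇ : ∀ k m → k * 𝟙 (k <ᵇ m) ≤ m
*-𝟙-<ᵇ k m with k <ᵇ m | <ᵇ-reflects-< k m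
... | true  | ofʸ k<m = ≤-trans (≤-reflexive (*-identityʳ k)) (<⇒≤ k<m)
... | false | _       = ≤-trans (≤-reflexive (*-zeroʳ k)) z≤n

infix 5 _∈[_,_⟩
_∈[_,_⟩ : ℕ → ℕ → ℕ → Bool
x ∈[ lo , hi ⟩ = (lo ≤ᵇ x) ∧ (x <ᵇ hi)

𝟙-<ᵇ-split : ∀ {lo hi} x → lo ≤ hi → 𝟙 (x <ᵇ hi) ≡ 𝟙 (x <ᵇ lo) + 𝟙 (x ∈[ lo , hi ⟩)
𝟙-<ᵇ-split {lo} {hi} x lo≤hi
  with x <ᵇ lo | <ᵇ-reflects-< x lo | lo ≤ᵇ x | ≤ᵇ-reflects-≤ lo x | x <ᵇ hi | <ᵇ-reflects-< x hi
... | true  | ofʸ x<lo | true  | ofʸ lo≤x | _     | _        = contradiction lo≤x (<⇒≱ x<lo)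
... | false | ofⁿ x≮lo | false | ofⁿ lo≰x | _     | _        = contradiction (≮⇒≥ x≮lo) lo≰x
... | true  | ofʸ x<lo | false | _        | false | ofⁿ x≮hi = contradiction (<-≤-trans x<lo lo≤hi) x≮hi
... | true  | _        | false | _        | true  | _        = refl
... | false | _        | true  | _        | true  | _        = refl
... | false | _        | true  | _        | false | _        = refl

𝟙-≤ᵇ-split : ∀ {lo hi} x → lo ≤ hi → 𝟙 (lo ≤ᵇ x) ≡ 𝟙 (hi ≤ᵇ x) + 𝟙 (x ∈[ lo , hi ⟩)
𝟙-≤ᵇ-split {lo} {hi} x lo≤hi
  with lo ≤ᵇ x | ≤ᵇ-reflects-≤ lo x | hi ≤ᵇ x | ≤ᵇ-reflects-≤ hi x | x <ᵇ hi | <ᵇ-reflects-< x hi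
... | false | ofⁿ lo≰x | true  | ofʸ hi≤x | _     | _        = contradiction (≤-trans lo≤hi hi≤x) lo≰x
... | _     | _        | true  | ofʸ hi≤x | true  | ofʸ x<hi = contradiction hi≤x (<⇒≱ x<hi)
... | _     | _        | false | ofⁿ hi≰x | false | ofⁿ x≮hi = contradiction (≮⇒≥ x≮hi) hi≰x
... | false | _        | false | _        | _     | _        = refl
... | true  | _        | true  | _        | false | _        = refl
... | true  | _        | false | _        | true  | _        = refl

𝟙-shift : ∀ {lo hi} L x y → lo ≤ hi →
  𝟙 ((lo ≤ᵇ L) ∧ x) + 𝟙 ((L <ᵇ lo) ∧ y) + 𝟙 ((L ∈[ lo , hi ⟩) ∧ y) ≡
  𝟙 ((hi ≤ᵇ L) ∧ x) + 𝟙 ((L <ᵇ hi) ∧ y) + 𝟙 ((L ∈[ lo , hi ⟩) ∧ x)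
𝟙-shift {lo} {hi} L x y lo≤hi
  rewrite 𝟙-∧-split (lo ≤ᵇ L) (hi ≤ᵇ L) (L ∈[ lo , hi ⟩) x (𝟙-≤ᵇ-split L lo≤hi)
        | 𝟙-∧-split (L <ᵇ hi) (L <ᵇ lo) (L ∈[ lo , hi ⟩) y (𝟙-<ᵇ-split L lo≤hi) =
    rearrange (𝟙 ((hi ≤ᵇ L) ∧ x)) (𝟙 ((L <ᵇ lo) ∧ y)) (𝟙 ((L ∈[ lo , hi ⟩) ∧ x)) (𝟙 ((L ∈[ lo , hi ⟩) ∧ y))
  where
  rearrange : ∀ a b c d → a + c + b + d ≡ a + (b + d) + c
  rearrange a b c d = solve (a ∷ b ∷ c ∷ d ∷ [])

count : ∀ {n} → (Fin n → Bool) → ℕ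
count {n} P = ∑[ p < n ] 𝟙 (P p)

sum-mono-≤ : ∀ {n} {f g : Fin n → ℕ} → (∀ i → f i ≤ g i) → sum f ≤ sum g
sum-mono-≤ {zero}  f≤g = z≤n
sum-mono-≤ {suc n} f≤g = +-mono-≤ (f≤g 0F) (sum-mono-≤ (f≤g ∘ sucF))

count-∧-not : ∀ {m} (b x : Fin m → Bool) →
  count (λ l → b l ∧ x l) + count (λ l → b l ∧ not (x l)) ≡ count b
count-∧-not {m} b x = trans (sym (∑-distrib-+ {m} _ _)) (sum-cong-≗ {m} (λ l → 𝟙-∧-not (b l) (x l)))

twice-≤-count : ∀ {m} (b x : Fin m → Bool) →
  count (λ l → b l ∧ x l) ≤ count (λ l → b l ∧ not (x l)) → 2 * count (λ l → b l ∧ x l) ≤ count b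
twice-≤-count b x minority = begin
  2 * hits                                   ≡⟨ cong (hits +_) (+-identityʳ hits) ⟩
  hits + hits                                 ≤⟨ +-monoʳ-≤ hits minority ⟩
  hits + count (λ l → b l ∧ not (x l))       ≡⟨ count-∧-not b x ⟩
  count b                                   ∎
  where
  open ≤-Reasoning
  hits : ℕ
  hits = count (λ l → b l ∧ x l)

count-remove : ∀ {m} (P : Fin (suc m) → Bool) s → P s ≡ false → count P ≡ count (P ∘ punchIn s)
count-remove {m} P s Ps≡false =
  trans (sum-remove {m} {i = s} (𝟙 ∘ P)) (cong (λ b → 𝟙 b + count (P ∘ punchIn s)) Ps≡false)

count-< : ∀ {n} b → b ≤ n → count {n} (λ p → toℕ p <ᵇ b) ≡ b
count-< {n}     zero    _         = sum-replicate-zero n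
count-< {suc n} (suc b) (s≤s b≤n) = cong suc (count-< b b≤n)

count-∈ : ∀ {n lo hi} → lo ≤ hi → hi ≤ n → count {n} (λ p → toℕ p ∈[ lo , hi ⟩) ≡ hi ∸ lo
count-∈ {n} {lo} {hi} lo≤hi hi≤n = begin
  between                   ≡⟨ sym (m+n∸m≡n lo between) ⟩
  lo + between ∸ lo         ≡⟨ cong (λ k → k + between ∸ lo) (sym (count-< {n} lo (≤-trans lo≤hi hi≤n))) ⟩
  below lo + between ∸ lo   ≡⟨ cong (_∸ lo) below-lo+between ⟩
  below hi ∸ lo             ≡⟨ cong (_∸ lo) (count-< {n} hi hi≤n) ⟩
  hi ∸ lo                   ∎
  where
  open ≡-Reasoning
  below : ℕ → ℕ
  below b = count {n} (λ p → toℕ p <ᵇ b)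
  between : ℕ
  between = count {n} (λ p → toℕ p ∈[ lo , hi ⟩)
  below-lo+between : below lo + between ≡ below hi
  below-lo+between = trans (sym (∑-distrib-+ {n} _ _)) (sum-cong-≗ {n} (λ p → sym (𝟙-<ᵇ-split (toℕ p) lo≤hi)))

markov : ∀ {m} k (f : Fin m → ℕ) → k * count (λ p → k <ᵇ f p) ≤ sum f
markov {m} k f = begin
  k * count (λ p → k <ᵇ f p)     ≡⟨ *-distribˡ-sum {m} k _ ⟩
  ∑[ p < m ] (k * 𝟙 (k <ᵇ f p)) ≤⟨ sum-mono-≤ {m} (λ p → *-𝟙-<ᵇ k (f p)) ⟩
  sum f                         ∎
  where open ≤-Reasoning

listSum-tabulate : ∀ {A : Set} {n} (g : A → ℕ) (f : Fin n → A) →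
  List.sum (map g (tabulate f)) ≡ sum (g ∘ f)
listSum-tabulate {n = zero}  g f = refl
listSum-tabulate {n = suc n} g f = cong (g (f 0F) +_) (listSum-tabulate g (f ∘ sucF))

listSum-cartesianProduct : ∀ {A B : Set} (h : A × B → ℕ) (xs : List A) (ys : List B) →
  List.sum (map h (cartesianProduct xs ys)) ≡
  List.sum (map (λ x → List.sum (map (λ y → h (x , y)) ys)) xs)
listSum-cartesianProduct h []       ys = refl
listSum-cartesianProduct h (x ∷ xs) ys = begin
  List.sum (map h (map (x ,_) ys ++ cartesianProduct xs ys))
    ≡⟨ cong List.sum (map-++ h (map (x ,_) ys) _) ⟩
  List.sum (map h (map (x ,_) ys) ++ map h (cartesianProduct xs ys))
    ≡⟨ sum-++ (map h (map (x ,_) ys)) _ ⟩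
  List.sum (map h (map (x ,_) ys)) + List.sum (map h (cartesianProduct xs ys))
    ≡⟨ cong₂ _+_ (cong List.sum (sym (map-∘ ys))) (listSum-cartesianProduct h xs ys) ⟩
  _ ∎
  where open ≡-Reasoning

countV≡count : ∀ {n} (P : Fin n → Bool) → countV P ≡ count P
countV≡count {n} P = listSum-tabulate {n = n} _ (λ p → p)

countP≡∑count : ∀ {n} (P : Fin n → Fin n → Bool) → countP P ≡ ∑[ p < n ] count (P p)
countP≡∑count {n} P = begin
  countP P
    ≡⟨ listSum-cartesianProduct (λ pq → 𝟙 (P (proj₁ pq) (proj₂ pq))) (allFin n) (allFin n) ⟩
  List.sum (map (λ p → List.sum (map (λ q → 𝟙 (P p q)) (allFin n))) (allFin n))
    ≡⟨ listSum-tabulate {n = n} _ (λ p → p) ⟩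
  ∑[ p < n ] List.sum (map (λ q → 𝟙 (P p q)) (allFin n))
    ≡⟨ sum-cong-≗ {n} (λ p → listSum-tabulate {n = n} _ (λ q → q)) ⟩
  ∑[ p < n ] count (P p) ∎
  where open ≡-Reasoning

countP-split : ∀ {n} (R S : Fin n → Fin n → Bool) →
  countP (λ p q → R p q ∧ S p q) + countP (λ p q → R p q ∧ not (S p q)) ≡ countP R
countP-split {n} R S = begin
  countP with-S + countP without-S
    ≡⟨ cong₂ _+_ (countP≡∑count with-S) (countP≡∑count without-S) ⟩
  ∑[ p < n ] count (with-S p) + ∑[ p < n ] count (without-S p)
    ≡⟨ sym (∑-distrib-+ {n} (λ p → count (with-S p)) _) ⟩
  ∑[ p < n ] (count (with-S p) + count (without-S p))
    ≡⟨ sum-cong-≗ {n} (λ p → count-∧-not (R p) (S p)) ⟩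
  ∑[ p < n ] count (R p)
    ≡⟨ sym (countP≡∑count R) ⟩
  countP R ∎
  where
  open ≡-Reasoning
  with-S without-S : Fin n → Fin n → Bool
  with-S    p q = R p q ∧ S p q
  without-S p q = R p q ∧ not (S p q)

countP-∧-≤ : ∀ {n} (R S : Fin n → Fin n → Bool) → countP (λ p q → R p q ∧ S p q) ≤ countP R
countP-∧-≤ R S = subst (countP (λ p q → R p q ∧ S p q) ≤_) (countP-split R S) (m≤m+n _ _)

countP-∧-≤-* : ∀ {n} (R : Fin n → Fin n → Bool) (A B : Fin n → Bool) →
  countP (λ p q → R p q ∧ (A p ∧ B q)) ≤ count A * count B
countP-∧-≤-* {n} R A B = begin
  countP (λ p q → R p q ∧ (A p ∧ B q))         ≡⟨ countP≡∑count (λ p q → R p q ∧ (A p ∧ B q)) ⟩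
  ∑[ p < n ] ∑[ q < n ] 𝟙 (R p q ∧ (A p ∧ B q)) ≤⟨ sum-mono-≤ {n} (λ p → sum-mono-≤ {n} (pointwise p)) ⟩
  ∑[ p < n ] ∑[ q < n ] (𝟙 (A p) * 𝟙 (B q))     ≡⟨ sum-cong-≗ {n} (λ p → sym (*-distribˡ-sum {n} (𝟙 (A p)) _)) ⟩
  ∑[ p < n ] (𝟙 (A p) * count B)                ≡⟨ sym (*-distribʳ-sum {n} (count B) _) ⟩
  count A * count B                             ∎
  where
  open ≤-Reasoning
  pointwise : ∀ p q → 𝟙 (R p q ∧ (A p ∧ B q)) ≤ 𝟙 (A p) * 𝟙 (B q)
  pointwise p q = ≤-trans (𝟙-∧-≤ʳ (R p q) (A p ∧ B q)) (≤-reflexive (𝟙-∧ (A p) (B q)))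

-- Positions of the remaining vertices after removing one

toℕ-punchIn-< : ∀ {m} (i : Fin (suc m)) j → toℕ j < toℕ i → toℕ (punchIn i j) ≡ toℕ j
toℕ-punchIn-< (sucF i) 0F       _         = refl
toℕ-punchIn-< (sucF i) (sucF j) (s≤s j<i) = cong suc (toℕ-punchIn-< i j j<i)

toℕ-punchIn-≥ : ∀ {m} (i : Fin (suc m)) j → toℕ i ≤ toℕ j → toℕ (punchIn i j) ≡ suc (toℕ j)
toℕ-punchIn-≥ 0F       j        _         = refl
toℕ-punchIn-≥ (sucF i) (sucF j) (s≤s i≤j) = cong suc (toℕ-punchIn-≥ i j i≤j)

punchIn-<ᵇ : ∀ {m} (i : Fin (suc m)) j k →
  (toℕ (punchIn i j) <ᵇ toℕ (punchIn i k)) ≡ (toℕ j <ᵇ toℕ k)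
punchIn-<ᵇ 0F       j        k        = refl
punchIn-<ᵇ (sucF i) 0F       0F       = refl
punchIn-<ᵇ (sucF i) 0F       (sucF k) = refl
punchIn-<ᵇ (sucF i) (sucF j) 0F       = refl
punchIn-<ᵇ (sucF i) (sucF j) (sucF k) = punchIn-<ᵇ i j k

<ᵇ-punchIn : ∀ {m} (i : Fin (suc m)) j → (toℕ i <ᵇ toℕ (punchIn i j)) ≡ (toℕ i ≤ᵇ toℕ j)
<ᵇ-punchIn 0F       j        = refl
<ᵇ-punchIn (sucF i) 0F       = refl
<ᵇ-punchIn (sucF i) (sucF j) = trans (<ᵇ-punchIn i j) (≤ᵇ≡<ᵇsuc (toℕ i) (toℕ j))

punchIn-<ᵇ-self : ∀ {m} (i : Fin (suc m)) j → (toℕ (punchIn i j) <ᵇ toℕ i) ≡ (toℕ j <ᵇ toℕ i)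
punchIn-<ᵇ-self 0F       j        = refl
punchIn-<ᵇ-self (sucF i) 0F       = refl
punchIn-<ᵇ-self (sucF i) (sucF j) = punchIn-<ᵇ-self i j

punchIn-∈-after : ∀ {m} (i : Fin (suc m)) j hi →
  toℕ (punchIn i j) ∈[ suc (toℕ i) , suc hi ⟩ ≡ toℕ j ∈[ toℕ i , hi ⟩
punchIn-∈-after i j hi rewrite <ᵇ-punchIn i j
  with toℕ i ≤ᵇ toℕ j | ≤ᵇ-reflects-≤ (toℕ i) (toℕ j)
... | false | _       = refl
... | true  | ofʸ i≤j rewrite toℕ-punchIn-≥ i j i≤j = refl

punchIn-∈-before : ∀ {m} (i : Fin (suc m)) j lo →
  toℕ (punchIn i j) ∈[ lo , toℕ i ⟩ ≡ toℕ j ∈[ lo , toℕ i ⟩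
punchIn-∈-before i j lo rewrite punchIn-<ᵇ-self i j
  with toℕ j <ᵇ toℕ i | <ᵇ-reflects-< (toℕ j) (toℕ i)
... | false | _       = trans (∧-zeroʳ _) (sym (∧-zeroʳ _))
... | true  | ofʸ j<i rewrite toℕ-punchIn-< i j j<i = refl

-- Backward edges of a reordering

inversions : ∀ {n} → (Fin n → Fin n → Bool) → (Fin n → ℕ) → ℕ
inversions {n} R k = ∑[ p < n ] ∑[ q < n ] 𝟙 ((k p <ᵇ k q) ∧ R q p)

inversions-permute : ∀ {n} (R : Fin n → Fin n → Bool) k (π : Permutation′ n) →
  inversions R k ≡ inversions (λ q p → R (π ⟨$⟩ʳ q) (π ⟨$⟩ʳ p)) (k ∘ (π ⟨$⟩ʳ_))
inversions-permute {n} R k π = trans (sum-permute {n} _ π)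
  (sum-cong-≗ {n} (λ p → sum-permute {n} (λ q → 𝟙 ((k (π ⟨$⟩ʳ p) <ᵇ k q) ∧ R q (π ⟨$⟩ʳ p))) π))

inversions-cong : ∀ {n} {R R′ : Fin n → Fin n → Bool} {k k′ : Fin n → ℕ} →
  (∀ q p → R q p ≡ R′ q p) → (∀ p q → (k p <ᵇ k q) ≡ (k′ p <ᵇ k′ q)) → inversions R k ≡ inversions R′ k′
inversions-cong {n} {R} {k = k} R≗R′ same-order =
  sum-cong-≗ {n} (λ p → sum-cong-≗ {n} (λ q → cong₂ (λ c b → 𝟙 (c ∧ b)) (same-order p q) (R≗R′ q p)))

adjAt : ∀ {n} → Tournament n → Permutation′ n → Fin n → Fin n → Bool
adjAt T σ p q = adj T (σ ⟨$⟩ʳ p) (σ ⟨$⟩ʳ q)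

adjAt-flip : ∀ {n} (T : Tournament n) σ {p q} → p ≢ q → adjAt T σ p q ≡ not (adjAt T σ q p)
adjAt-flip T σ {p} {q} p≢q = tourn T _ _ (p≢q ∘ permutation-injective)
  where
  permutation-injective : σ ⟨$⟩ʳ p ≡ σ ⟨$⟩ʳ q → p ≡ q
  permutation-injective e = trans (sym (inverseˡ σ)) (trans (cong (σ ⟨$⟩ˡ_) e) (inverseˡ σ))

backCount≡inversions : ∀ {n} (T : Tournament n) σ → backCount T σ ≡ inversions (adjAt T σ) toℕ
backCount≡inversions T σ = countP≡∑count (isBack T σ)

backCount-flip∘ₚ : ∀ {n} (T : Tournament n) σ (π : Permutation′ n) →
  backCount T (flip π ∘ₚ σ) ≡ inversions (adjAt T σ) (toℕ ∘ (π ⟨$⟩ʳ_))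
backCount-flip∘ₚ {n} T σ π = begin
  backCount T (flip π ∘ₚ σ)
    ≡⟨ backCount≡inversions T (flip π ∘ₚ σ) ⟩
  inversions (adjAt T (flip π ∘ₚ σ)) toℕ
    ≡⟨ inversions-permute (adjAt T (flip π ∘ₚ σ)) toℕ π ⟩
  inversions (λ q p → adjAt T σ (π ⟨$⟩ˡ (π ⟨$⟩ʳ q)) (π ⟨$⟩ˡ (π ⟨$⟩ʳ p))) key
    ≡⟨ inversions-cong {n} {k = key} {k′ = key} (λ q p → cong₂ (adjAt T σ) (inverseˡ π) (inverseˡ π))
                                             (λ p q → refl) ⟩
  inversions (adjAt T σ) key ∎
  where
  open ≡-Reasoning
  key : Fin n → ℕ
  key = toℕ ∘ (π ⟨$⟩ʳ_)

-- The backward edges at the vertex in position s after reinserting it just before the remaining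
-- vertices numbered t, t + 1, … (positions other than s are numbered by punchIn s).
insertionCost : ∀ {m} → (Fin (suc m) → Fin (suc m) → Bool) → Fin (suc m) → ℕ → ℕ
insertionCost {m} R s t =
  ∑[ l < m ] (𝟙 ((t ≤ᵇ toℕ l) ∧ R (punchIn s l) s) + 𝟙 ((toℕ l <ᵇ t) ∧ R s (punchIn s l)))

inversions-remove : ∀ {m} (R : Fin (suc m) → Fin (suc m) → Bool) k s →
  inversions R k ≡
  inversions (λ q p → R (punchIn s q) (punchIn s p)) (k ∘ punchIn s) +
  ∑[ l < m ] (𝟙 ((k s <ᵇ k (punchIn s l)) ∧ R (punchIn s l) s) +
              𝟙 ((k (punchIn s l) <ᵇ k s) ∧ R s (punchIn s l)))
inversions-remove {m} R k s = begin
  ∑[ p < suc m ] ∑[ q < suc m ] F p q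
    ≡⟨ sum-remove {m} {i = s} (λ p → ∑[ q < suc m ] F p q) ⟩
  ∑[ q < suc m ] F s q + ∑[ l < m ] ∑[ q < suc m ] F (punchIn s l) q
    ≡⟨ cong₂ _+_ (sum-remove {m} {i = s} (F s))
                 (sum-cong-≗ {m} (λ l → sum-remove {m} {i = s} (F (punchIn s l)))) ⟩
  F s s + sum A + ∑[ l < m ] (B l + C l)
    ≡⟨ cong₂ (λ d e → d + sum A + e) diagonal (∑-distrib-+ {m} B C) ⟩
  sum A + (sum B + sum C)
    ≡⟨ rearrange (sum A) (sum B) (sum C) ⟩
  sum C + (sum A + sum B)
    ≡⟨ cong (sum C +_) (sym (∑-distrib-+ {m} A B)) ⟩
  sum C + ∑[ l < m ] (A l + B l) ∎
  where
  open ≡-Reasoning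
  rearrange : ∀ a b c → a + (b + c) ≡ c + (a + b)
  rearrange a b c = solve (a ∷ b ∷ c ∷ [])
  F : Fin (suc m) → Fin (suc m) → ℕ
  F p q = 𝟙 ((k p <ᵇ k q) ∧ R q p)
  A B C : Fin m → ℕ
  A l = F s (punchIn s l)
  B l = F (punchIn s l) s
  C l = ∑[ l′ < m ] F (punchIn s l) (punchIn s l′)
  diagonal : F s s ≡ 0
  diagonal rewrite <ᵇ-irrefl (k s) = refl

inversions-insert : ∀ {m} (R : Fin (suc m) → Fin (suc m) → Bool) s t (f : Fin (suc m) → Fin (suc m)) →
  f s ≡ t → (∀ l → f (punchIn s l) ≡ punchIn t l) →
  inversions R (toℕ ∘ f) ≡ inversions (λ q p → R (punchIn s q) (punchIn s p)) toℕ + insertionCost R s (toℕ t)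
inversions-insert {m} R s t f fs≡t f∘punchIn = trans (inversions-remove R (toℕ ∘ f) s) (cong₂ _+_
  (inversions-cong {m} {k = toℕ ∘ f ∘ punchIn s} {k′ = toℕ} (λ q p → refl) same-order)
  (sum-cong-≗ {m} (λ l → cong₂ _+_ (after l) (before l))))
  where
  k∘punchIn : ∀ l → toℕ (f (punchIn s l)) ≡ toℕ (punchIn t l)
  k∘punchIn l = cong toℕ (f∘punchIn l)
  same-order : ∀ l l′ → (toℕ (f (punchIn s l)) <ᵇ toℕ (f (punchIn s l′))) ≡ (toℕ l <ᵇ toℕ l′)
  same-order l l′ rewrite k∘punchIn l | k∘punchIn l′ = punchIn-<ᵇ t l l′
  after : ∀ l → 𝟙 ((toℕ (f s) <ᵇ toℕ (f (punchIn s l))) ∧ R (punchIn s l) s) ≡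
                𝟙 ((toℕ t ≤ᵇ toℕ l) ∧ R (punchIn s l) s)
  after l rewrite fs≡t | k∘punchIn l | <ᵇ-punchIn t l = refl
  before : ∀ l → 𝟙 ((toℕ (f (punchIn s l)) <ᵇ toℕ (f s)) ∧ R s (punchIn s l)) ≡
                 𝟙 ((toℕ l <ᵇ toℕ t) ∧ R s (punchIn s l))
  before l rewrite fs≡t | k∘punchIn l | punchIn-<ᵇ-self t l = refl

insertionCost-split : ∀ {m} R (s : Fin (suc m)) {lo hi} → lo ≤ hi →
  insertionCost R s lo + ∑[ l < m ] 𝟙 ((toℕ l ∈[ lo , hi ⟩) ∧ R s (punchIn s l)) ≡
  insertionCost R s hi + ∑[ l < m ] 𝟙 ((toℕ l ∈[ lo , hi ⟩) ∧ R (punchIn s l) s)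
insertionCost-split {m} R s lo≤hi = trans (sym (∑-distrib-+ {m} _ _))
  (trans (sum-cong-≗ {m} (λ l → 𝟙-shift (toℕ l) (R (punchIn s l) s) (R s (punchIn s l)) lo≤hi))
         (∑-distrib-+ {m} _ _))

move : ∀ {m} → Fin (suc m) → Fin (suc m) → Permutation′ (suc m)
move s t = insert s t id

move-source : ∀ {m} (s t : Fin (suc m)) → move s t ⟨$⟩ʳ s ≡ t
move-source s t with s Fin.≟ s
... | yes _   = refl
... | no s≢s = contradiction refl s≢s

-- Optimal orderings

optimal-insertionCost : ∀ {m} {T : Tournament (suc m)} {σ} → Optimal T σ → ∀ s t →
  insertionCost (adjAt T σ) s (toℕ s) ≤ insertionCost (adjAt T σ) s (toℕ t)
optimal-insertionCost {m} {T} {σ} opt s t = +-cancelˡ-≤ away _ _ (begin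
  away + insertionCost R s (toℕ s)       ≡⟨ sym (inversions-insert R s s (λ p → p) refl (λ _ → refl)) ⟩
  inversions R toℕ                       ≡⟨ sym (backCount≡inversions T σ) ⟩
  backCount T σ                          ≤⟨ opt (flip (move s t) ∘ₚ σ) ⟩
  backCount T (flip (move s t) ∘ₚ σ)     ≡⟨ backCount-flip∘ₚ T σ (move s t) ⟩
  inversions R (toℕ ∘ (move s t ⟨$⟩ʳ_))
    ≡⟨ inversions-insert R s t (move s t ⟨$⟩ʳ_) (move-source s t) (insert-punchIn s t id) ⟩
  away + insertionCost R s (toℕ t)       ∎)
  where
  open ≤-Reasoning
  R = adjAt T σ
  away = inversions (λ q p → R (punchIn s q) (punchIn s p)) toℕ

optimal-leftEndpoint-bound : ∀ {m} {T : Tournament (suc m)} {σ} → Optimal T σ → (i j : Fin (suc m)) →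
  toℕ i ≤ toℕ j →
  2 * count (λ p → (toℕ p ∈[ suc (toℕ i) , suc (toℕ j) ⟩) ∧ adjAt T σ p i) ≤ toℕ j ∸ toℕ i
optimal-leftEndpoint-bound {m} {T} {σ} opt i j i≤j = begin
  2 * count (λ p → In⁺ p ∧ R p i)             ≡⟨ cong (2 *_) removed ⟩
  2 * count (λ l → In l ∧ R (punchIn i l) i)  ≤⟨ twice-≤-count In (λ l → R (punchIn i l) i) minority ⟩
  count In                                    ≡⟨ count-∈ {m} i≤j (toℕ≤pred[n] j) ⟩
  toℕ j ∸ toℕ i                               ∎
  where
  open ≤-Reasoning
  R = adjAt T σ
  In⁺ : Fin (suc m) → Bool
  In⁺ p = toℕ p ∈[ suc (toℕ i) , suc (toℕ j) ⟩
  In : Fin m → Bool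
  In l = toℕ l ∈[ toℕ i , toℕ j ⟩
  outside : (In⁺ i ∧ R i i) ≡ false
  outside rewrite <ᵇ-irrefl (toℕ i) = refl
  shift : ∀ l → 𝟙 (In⁺ (punchIn i l) ∧ R (punchIn i l) i) ≡ 𝟙 (In l ∧ R (punchIn i l) i)
  shift l = cong (λ b → 𝟙 (b ∧ R (punchIn i l) i)) (punchIn-∈-after i l (toℕ j))
  removed : count (λ p → In⁺ p ∧ R p i) ≡ count (λ l → In l ∧ R (punchIn i l) i)
  removed = trans (count-remove (λ p → In⁺ p ∧ R p i) i outside) (sum-cong-≗ {m} shift)
  minority : count (λ l → In l ∧ R (punchIn i l) i) ≤ count (λ l → In l ∧ not (R (punchIn i l) i))
  minority = subst (count (λ l → In l ∧ R (punchIn i l) i) ≤_)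
    (sum-cong-≗ {m} (λ l → cong (λ b → 𝟙 (In l ∧ b)) (adjAt-flip T σ (punchInᵢ≢i i l ∘ sym))))
    (+-≡-cancel-≤ (sym (insertionCost-split R i i≤j)) (optimal-insertionCost {T = T} {σ = σ} opt i j))

optimal-rightEndpoint-bound : ∀ {m} {T : Tournament (suc m)} {σ} → Optimal T σ → (i j : Fin (suc m)) →
  toℕ i ≤ toℕ j → 2 * count (λ p → (toℕ p ∈[ toℕ i , toℕ j ⟩) ∧ adjAt T σ j p) ≤ toℕ j ∸ toℕ i
optimal-rightEndpoint-bound {m} {T} {σ} opt i j i≤j = begin
  2 * count {suc m} (λ p → In p ∧ R j p)      ≡⟨ cong (2 *_) removed ⟩
  2 * count (λ l → In l ∧ R j (punchIn j l))  ≤⟨ twice-≤-count {m} In (λ l → R j (punchIn j l)) minority ⟩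
  count {m} In                                ≡⟨ count-∈ {m} i≤j (toℕ≤pred[n] j) ⟩
  toℕ j ∸ toℕ i                               ∎
  where
  open ≤-Reasoning
  R = adjAt T σ
  In : ∀ {k} → Fin k → Bool
  In l = toℕ l ∈[ toℕ i , toℕ j ⟩
  outside : (In j ∧ R j j) ≡ false
  outside rewrite <ᵇ-irrefl (toℕ j) | ∧-zeroʳ (toℕ i ≤ᵇ toℕ j) = refl
  shift : ∀ l → 𝟙 (In (punchIn j l) ∧ R j (punchIn j l)) ≡ 𝟙 (In l ∧ R j (punchIn j l))
  shift l = cong (λ b → 𝟙 (b ∧ R j (punchIn j l))) (punchIn-∈-before j l (toℕ i))
  removed : count {suc m} (λ p → In p ∧ R j p) ≡ count (λ l → In l ∧ R j (punchIn j l))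
  removed = trans (count-remove (λ p → In p ∧ R j p) j outside) (sum-cong-≗ {m} shift)
  minority : count (λ l → In l ∧ R j (punchIn j l)) ≤ count (λ l → In l ∧ not (R j (punchIn j l)))
  minority = subst (count (λ l → In l ∧ R j (punchIn j l)) ≤_)
    (sum-cong-≗ {m} (λ l → cong (λ b → 𝟙 (In l ∧ b)) (adjAt-flip T σ (punchInᵢ≢i j l))))
    (+-≡-cancel-≤ (insertionCost-split R j i≤j) (optimal-insertionCost {T = T} {σ = σ} opt j i))

-- Directed triangles at a long backward edge

backEdgesFrom backEdgesTo : ∀ {n} → Tournament n → Permutation′ n → Fin n → ℕ
backEdgesFrom T σ p = count (isBack T σ p)
backEdgesTo   T σ q = count (λ p → isBack T σ p q)

trianglesThrough≡count : ∀ {n} (T : Tournament n) σ i j →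
  trianglesThrough T σ i j ≡ count (λ p → adjAt T σ j i ∧ adjAt T σ i p ∧ adjAt T σ p j)
trianglesThrough≡count {n} T σ i j = trans (countV≡count {n} _) (sum-permute {n} _ σ)

triangle-cover : ∀ {n} (T : Tournament n) σ {i j} p → toℕ i < toℕ j → adjAt T σ j i ≡ true →
  toℕ p ∈[ toℕ i , suc (toℕ j) ⟩ ≡ true →
  (adjAt T σ j i ∧ adjAt T σ i p ∧ adjAt T σ p j) ≡ true ⊎
  ((toℕ p ∈[ suc (toℕ i) , suc (toℕ j) ⟩) ∧ adjAt T σ p i) ≡ true ⊎
  ((toℕ p ∈[ toℕ i , toℕ j ⟩) ∧ adjAt T σ j p) ≡ true
triangle-cover T σ {i} {j} p i<j j→i p∈[i,j]
  with p Fin.≟ i | p Fin.≟ j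
... | yes refl | _        =
  inj₂ (inj₂ (cong₂ _∧_ (cong₂ _∧_ (≤⇒≤ᵇ≡true (≤-refl {toℕ i})) (<⇒<ᵇ≡true i<j)) j→i))
... | no _     | yes refl =
  inj₂ (inj₁ (cong₂ _∧_ (cong₂ _∧_ (<⇒<ᵇ≡true i<j) (<⇒<ᵇ≡true (n<1+n (toℕ j)))) j→i))
... | no p≢i   | no p≢j   =
  strictly-between (≤∧≢⇒< i≤p (p≢i ∘ sym ∘ toℕ-injective)) (≤∧≢⇒< p≤j (p≢j ∘ toℕ-injective))
  where
  i≤p : toℕ i ≤ toℕ p
  i≤p = ≤ᵇ≡true⇒≤ (∧-conicalˡ _ _ p∈[i,j])
  p≤j : toℕ p ≤ toℕ j
  p≤j = ≤-pred (<ᵇ≡true⇒< (∧-conicalʳ _ _ p∈[i,j]))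
  strictly-between : toℕ i < toℕ p → toℕ p < toℕ j →
    (adjAt T σ j i ∧ adjAt T σ i p ∧ adjAt T σ p j) ≡ true ⊎
    ((toℕ p ∈[ suc (toℕ i) , suc (toℕ j) ⟩) ∧ adjAt T σ p i) ≡ true ⊎
    ((toℕ p ∈[ toℕ i , toℕ j ⟩) ∧ adjAt T σ j p) ≡ true
  strictly-between i<p p<j with adjAt T σ p i in p→i | adjAt T σ j p in j→p
  ... | true  | _     = inj₂ (inj₁ (cong₂ _∧_ (cong₂ _∧_ (<⇒<ᵇ≡true i<p) (<⇒<ᵇ≡true (s≤s p≤j))) refl))
  ... | false | true  = inj₂ (inj₂ (cong₂ _∧_ (cong₂ _∧_ (≤⇒≤ᵇ≡true i≤p) (<⇒<ᵇ≡true p<j)) refl))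
  ... | false | false = inj₁ (cong₂ _∧_ j→i (cong₂ _∧_
          (trans (adjAt-flip T σ (p≢i ∘ sym)) (cong not p→i))
          (trans (adjAt-flip T σ p≢j) (cong not j→p))))

backEdge-covering : ∀ {n} (T : Tournament n) σ {i j} → isBack T σ i j ≡ true →
  suc (toℕ j ∸ toℕ i) ≤ trianglesThrough T σ i j
                        + count (λ p → (toℕ p ∈[ suc (toℕ i) , suc (toℕ j) ⟩) ∧ adjAt T σ p i)
                        + count (λ p → (toℕ p ∈[ toℕ i , toℕ j ⟩) ∧ adjAt T σ j p)
backEdge-covering {n} T σ {i} {j} back = begin
  suc (toℕ j ∸ toℕ i)                ≡⟨ sym (+-∸-assoc 1 (<⇒≤ i<j)) ⟩
  suc (toℕ j) ∸ toℕ i                ≡⟨ sym (count-∈ {n} (m≤n⇒m≤1+n (<⇒≤ i<j)) (toℕ<n j)) ⟩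
  count {n} (λ p → toℕ p ∈[ toℕ i , suc (toℕ j) ⟩)
    ≤⟨ sum-mono-≤ {n} (λ p → 𝟙-cover (Δ p) (X p) (Y p) (triangle-cover T σ p i<j j→i)) ⟩
  ∑[ p < n ] (𝟙 (Δ p) + 𝟙 (X p) + 𝟙 (Y p))
    ≡⟨ trans (∑-distrib-+ {n} _ _) (cong (_+ count Y) (∑-distrib-+ {n} _ _)) ⟩
  count Δ + count X + count Y
    ≡⟨ cong (λ t → t + count X + count Y) (sym (trianglesThrough≡count T σ i j)) ⟩
  trianglesThrough T σ i j + count X + count Y ∎
  where
  open ≤-Reasoning
  i<j = <ᵇ≡true⇒< (∧-conicalˡ _ _ back)
  j→i = ∧-conicalʳ _ _ back
  Δ X Y : Fin n → Bool
  Δ p = adjAt T σ j i ∧ adjAt T σ i p ∧ adjAt T σ p j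
  X p = (toℕ p ∈[ suc (toℕ i) , suc (toℕ j) ⟩) ∧ adjAt T σ p i
  Y p = (toℕ p ∈[ toℕ i , toℕ j ⟩) ∧ adjAt T σ j p

triangle-arith : ∀ {n t x y L} → suc L ≤ t + x + y → 64 * x ≤ n → 2 * y ≤ L → n ≤ 16 * L → n ≤ 64 * t
triangle-arith {n} {t} {x} {y} {L} cover 64x≤n 2y≤L n≤16L =
  +-cancelʳ-≤ (n + 32 * L) n (64 * t) (begin
    n + (n + 32 * L)            ≡⟨ solve (n ∷ L ∷ []) ⟩
    2 * n + 32 * L              ≤⟨ +-monoˡ-≤ (32 * L) (*-monoʳ-≤ 2 n≤16L) ⟩
    2 * (16 * L) + 32 * L       ≡⟨ solve (L ∷ []) ⟩
    64 * L                      ≤⟨ *-monoʳ-≤ 64 (n≤1+n L) ⟩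
    64 * suc L                  ≤⟨ *-monoʳ-≤ 64 cover ⟩
    64 * (t + x + y)            ≡⟨ solve (t ∷ x ∷ y ∷ []) ⟩
    64 * t + 64 * x + 32 * (2 * y) ≤⟨ +-mono-≤ (+-monoʳ-≤ (64 * t) 64x≤n) (*-monoʳ-≤ 32 2y≤L) ⟩
    64 * t + n + 32 * L         ≡⟨ +-assoc (64 * t) n (32 * L) ⟩
    64 * t + (n + 32 * L)       ∎)
  where open ≤-Reasoning

long-backEdge-triangles : ∀ {n} (T : Tournament n) σ → Optimal T σ → ∀ {i j} → isLongBack T σ i j ≡ true →
  64 * backEdgesFrom T σ i ≤ n ⊎ 64 * backEdgesTo T σ j ≤ n → n ≤ 64 * trianglesThrough T σ i j
long-backEdge-triangles {zero} _ _ _ {i = ()}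
long-backEdge-triangles {suc m} T σ opt {i} {j} long = [ left-light , right-light ]′
  where
  back = ∧-conicalˡ _ _ long
  i<j = <ᵇ≡true⇒< (∧-conicalˡ _ _ back)
  n≤16L = ≤ᵇ≡true⇒≤ (∧-conicalʳ _ _ long)
  cover = backEdge-covering T σ back
  t X Y L : ℕ
  t = trianglesThrough T σ i j
  X = count (λ p → (toℕ p ∈[ suc (toℕ i) , suc (toℕ j) ⟩) ∧ adjAt T σ p i)
  Y = count (λ p → (toℕ p ∈[ toℕ i , toℕ j ⟩) ∧ adjAt T σ j p)
  L = toℕ j ∸ toℕ i
  X≤from : X ≤ backEdgesFrom T σ i
  X≤from = sum-mono-≤ {suc m} (λ p → 𝟙-∧-dropʳ (toℕ i <ᵇ toℕ p) (toℕ p <ᵇ suc (toℕ j)) (adjAt T σ p i))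
  Y≤to : Y ≤ backEdgesTo T σ j
  Y≤to = sum-mono-≤ {suc m} (λ p → 𝟙-∧-dropˡ (toℕ i ≤ᵇ toℕ p) (toℕ p <ᵇ toℕ j) (adjAt T σ j p))
  left-light : 64 * backEdgesFrom T σ i ≤ suc m → suc m ≤ 64 * t
  left-light light = triangle-arith {t = t} {X} {Y} {L} cover
    (≤-trans (*-monoʳ-≤ 64 X≤from) light) (optimal-rightEndpoint-bound {T = T} {σ} opt i j (<⇒≤ i<j)) n≤16L
  right-light : 64 * backEdgesTo T σ j ≤ suc m → suc m ≤ 64 * t
  right-light light = triangle-arith {t = t} {Y} {X} {L} (≤-trans cover (≤-reflexive (xy∙z≈xz∙y t X Y)))
    (≤-trans (*-monoʳ-≤ 64 Y≤to) light) (optimal-leftEndpoint-bound {T = T} {σ} opt i j (<⇒≤ i<j)) n≤16L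

-- Heavy endpoints

sum-backEdgesFrom : ∀ {n} (T : Tournament n) σ → sum (backEdgesFrom T σ) ≡ backCount T σ
sum-backEdgesFrom T σ = sym (countP≡∑count (isBack T σ))

sum-backEdgesTo : ∀ {n} (T : Tournament n) σ → sum (backEdgesTo T σ) ≡ backCount T σ
sum-backEdgesTo {n} T σ = trans (∑-comm {n} {n} (λ q p → 𝟙 (isBack T σ p q))) (sum-backEdgesFrom T σ)

heavy : ℕ → ℕ → Bool
heavy n d = n <ᵇ 64 * d

heavy-count : ∀ {m} n (d : Fin m → ℕ) → n * count (λ p → heavy n (d p)) ≤ 64 * sum d
heavy-count {m} n d = ≤-trans (markov n (λ p → 64 * d p)) (≤-reflexive (sym (*-distribˡ-sum {m} 64 d)))

not-heavy : ∀ {n d} → heavy n d ≡ false → 64 * d ≤ n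
not-heavy light = ≮⇒≥ (λ heavy → contradiction (trans (sym (<⇒<ᵇ≡true heavy)) light) λ ())

lightLongBack : ∀ {n} → Tournament n → Permutation′ n → Fin n → Fin n → Bool
lightLongBack {n} T σ p q =
  isLongBack T σ p q ∧ not (heavy n (backEdgesFrom T σ p) ∧ heavy n (backEdgesTo T σ q))

heavy-pairs-arith : ∀ {n B D a b} → 65536 * B ≤ n * n → D ≤ a * b → n * a ≤ 64 * B → n * b ≤ 64 * B →
  D ≤ B → 16 * D ≤ B
heavy-pairs-arith {B = zero} _ _ _ _ D≤0 rewrite n≤0⇒n≡0 D≤0 = z≤n
heavy-pairs-arith {n} {suc B} {D} {a} {b} 2¹⁶B≤n² D≤ab na≤64B nb≤64B _ =
  *-cancelʳ-≤ (16 * D) (suc B) (4096 * suc B) (begin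
    16 * D * (4096 * suc B)    ≡⟨ solve (D ∷ B ∷ []) ⟩
    65536 * suc B * D          ≤⟨ *-monoˡ-≤ D 2¹⁶B≤n² ⟩
    n * n * D                  ≤⟨ *-monoʳ-≤ (n * n) D≤ab ⟩
    n * n * (a * b)            ≡⟨ solve (n ∷ a ∷ b ∷ []) ⟩
    n * a * (n * b)            ≤⟨ *-mono-≤ na≤64B nb≤64B ⟩
    64 * suc B * (64 * suc B)  ≡⟨ solve (B ∷ []) ⟩
    suc B * (4096 * suc B)     ∎)
  where open ≤-Reasoning

majority-arith : ∀ {B G D} → 16 * D ≤ B → B ≤ 4 * (G + D) → G + D ≤ 2 * G
majority-arith {B} {G} {D} 16D≤B B≤4[G+D] = begin
  G + D      ≤⟨ +-monoʳ-≤ G (≤-trans (m≤m+n D (2 * D)) 3D≤G) ⟩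
  G + G      ≡⟨ solve (G ∷ []) ⟩
  2 * G      ∎
  where
  open ≤-Reasoning
  4D≤G+D : 4 * D ≤ G + D
  4D≤G+D = *-cancelˡ-≤ 4 (begin
    4 * (4 * D)  ≡⟨ solve (D ∷ []) ⟩
    16 * D       ≤⟨ ≤-trans 16D≤B B≤4[G+D] ⟩
    4 * (G + D)  ∎)
  3D≤G : D + 2 * D ≤ G
  3D≤G = +-cancelʳ-≤ D (D + 2 * D) G (begin
    D + 2 * D + D  ≡⟨ solve (D ∷ []) ⟩
    4 * D          ≤⟨ 4D≤G+D ⟩
    G + D          ∎)

lightLongBack-count : ∀ {n} (T : Tournament n) σ → backCount T σ ≤ 4 * countP (isLongBack T σ) →
  2 ^ 16 * backCount T σ ≤ n * n → countP (isLongBack T σ) ≤ 2 * countP (lightLongBack T σ)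
lightLongBack-count {n} T σ B≤4P 2¹⁶B≤n² =
  subst (_≤ 2 * G) split
    (majority-arith {B} {G} {D} heavy-pairs-few (subst (λ P → B ≤ 4 * P) (sym split) B≤4P))
  where
  B = backCount T σ
  heavyFrom heavyTo : Fin n → Bool
  heavyFrom p = heavy n (backEdgesFrom T σ p)
  heavyTo   q = heavy n (backEdgesTo T σ q)
  heavyPair : Fin n → Fin n → Bool
  heavyPair p q = heavyFrom p ∧ heavyTo q
  G D : ℕ
  G = countP (lightLongBack T σ)
  D = countP (λ p q → isLongBack T σ p q ∧ heavyPair p q)
  split : G + D ≡ countP (isLongBack T σ)
  split = trans (+-comm G D) (countP-split (isLongBack T σ) heavyPair)
  heavy-pairs-few : 16 * D ≤ B
  heavy-pairs-few = heavy-pairs-arith {n} {B} {D} 2¹⁶B≤n²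
    (countP-∧-≤-* (isLongBack T σ) heavyFrom heavyTo)
    (subst (λ s → n * count heavyFrom ≤ 64 * s) (sum-backEdgesFrom T σ) (heavy-count n (backEdgesFrom T σ)))
    (subst (λ s → n * count heavyTo ≤ 64 * s) (sum-backEdgesTo T σ) (heavy-count n (backEdgesTo T σ)))
    (≤-trans (countP-∧-≤ (isLongBack T σ) heavyPair) (countP-∧-≤ (isBack T σ) _))

lightLongBack-triangles : ∀ {n} (T : Tournament n) σ → Optimal T σ → ∀ {i j} →
  lightLongBack T σ i j ≡ true → n ≤ 64 * trianglesThrough T σ i j
lightLongBack-triangles {n} T σ opt {i} {j} light = long-backEdge-triangles T σ opt (∧-conicalˡ _ _ light)
  (map-⊎ (not-heavy {d = backEdgesFrom T σ i}) (not-heavy {d = backEdgesTo T σ j}) not-both-heavy)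
  where
  not-both-heavy : heavy n (backEdgesFrom T σ i) ≡ false ⊎ heavy n (backEdgesTo T σ j) ≡ false
  not-both-heavy = not-∧≡true _ _ (∧-conicalʳ (isLongBack T σ i j) _ light)

lemma3p1 : (n : ℕ) (T : Tournament n) (σ : Permutation′ n) → Optimal T σ →
    backCount T σ ≤ 4 * countP (isLongBack T σ) →
    2 ^ 16 * backCount T σ ≤ n * n →
    Σ (Fin n → Fin n → Bool) (λ B'' →
      (∀ i j → B'' i j ≡ true → isLongBack T σ i j ≡ true) ×
      (countP (isLongBack T σ) ≤ 2 * countP B'') ×
      (∀ i j → B'' i j ≡ true → n ≤ 64 * trianglesThrough T σ i j))
lemma3p1 n T σ opt many-long sparse =
  lightLongBack T σ ,
  (λ i j light → ∧-conicalˡ _ _ light) ,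
  lightLongBack-count T σ many-long sparse ,
  (λ i j → lightLongBack-triangles T σ opt)
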